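{- Let $M$ and $N$ be matroids on disjoint finite sets $S$ and $T$, and let $N_0=N\oplus U_{0,S}$. If $M^+$ is any extension of $M$ to $S\cup T$ (i.e., a matroid on $S\cup T$ with $M^+|S=M$) with $r(M^+)=r(M)$, then the matroid union $M^+\vee N_0$ is a semidirect sum of $M$ and $N$.
   Context: $U_{0,S}$ is the rank-$0$ matroid on $S$ (all elements loops), so $N_0$ is the matroid on $S\cup T$ obtained from $N$ by adding the elements of $S$ as loops. For matroids $G$ and $H$ on the same set $E$, the matroid union $G\vee H$ is the matroid on $E$ whose independent sets are exactly the sets $I_G\cup I_H$ with $I_G$ independent in $G$ and $I_H$ independent in $H$. A semidirect sum of matroids $M$ on $S$ and $N$ on $T$ ($S\cap T=\emptyset$) is a matroid $K$ on $S\cup T$ with $K|S=M$ and $K/S=N$. -}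

module Defs where

open import Level using (Level; _⊔_) renaming (suc to lsuc)
open import Data.Nat using (ℕ; _+_; _<_; _≤_)
open import Data.Fin using (Fin)
open import Data.Fin.Subset using (Subset; ⊥; _∪_; _⊆_; _∈_; _∉_; ⁅_⁆; ∣_∣)
open import Data.Vec using (_++_)
open import Data.Product using (Σ; ∃; ∃₂; _×_; _,_)
open import Relation.Nullary using (Dec)
open import Relation.Binary.PropositionalEquality using (_≡_)
open import Function.Bundles using (_⇔_)

record IsMatroid {n : ℕ} (Ind : Subset n → Set) : Set where
  field
    -- matroids are finite objects; independence is decidable
    ind-dec    : (I : Subset n) → Dec (Ind I)
    ind-empty  : Ind ⊥
    ind-subset : ∀ {I J} → J ⊆ I → Ind I → Ind J
    ind-aug    : ∀ {I J} → Ind I → Ind J → ∣ I ∣ < ∣ J ∣ →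
                 Σ (Fin n) λ x → x ∈ J × x ∉ I × Ind (I ∪ ⁅ x ⁆)

record Matroid (n : ℕ) : Set₁ where
  field
    Ind       : Subset n → Set
    isMatroid : IsMatroid Ind

open Matroid public

HasRank : ∀ {n} → (Subset n → Set) → ℕ → Set
HasRank Ind k = (Σ _ λ I → Ind I × ∣ I ∣ ≡ k) × (∀ I → Ind I → ∣ I ∣ ≤ k)

-- Convention: for disjoint ground sets S = Fin s and T = Fin t, the ground
-- set S ∪ T is Fin (s + t), with S the first s elements and T the last t.
-- A subset A ⊆ S and B ⊆ T give the subset A ++ B of S ∪ T.

RestrictS : ∀ {s t} → (Subset (s + t) → Set) → Subset s → Set
RestrictS {s} {t} Ind A = Ind (A ++ ⊥ {t})

IsBasisS : ∀ {s t} → (Subset (s + t) → Set) → Subset s → Set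
IsBasisS {s} {t} Ind B =
  RestrictS {s} {t} Ind B × (∀ B′ → B ⊆ B′ → RestrictS {s} {t} Ind B′ → B′ ≡ B)

ContractS : ∀ {s t} → (Subset (s + t) → Set) → Subset t → Set
ContractS {s} {t} Ind J = Σ (Subset s) λ B → IsBasisS {s} {t} Ind B × Ind (B ++ J)

-- N₀ = N ⊕ U_{0,S}: N with the elements of S added as loops.
LoopsExt : ∀ {s t} → Matroid t → Subset (s + t) → Set
LoopsExt {s} {t} N I = Σ (Subset t) λ J → I ≡ (⊥ {s} ++ J) × Ind N J

UnionInd : ∀ {n} → (Subset n → Set) → (Subset n → Set) → Subset n → Set
UnionInd G H I = ∃₂ λ I₁ I₂ → G I₁ × H I₂ × I ≡ I₁ ∪ I₂

RestrictionIs : ∀ {s t} → (Subset (s + t) → Set) → Matroid s → Set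
RestrictionIs {s} {t} K M = ∀ A → RestrictS {s} {t} K A ⇔ Ind M A

ContractionIs : ∀ {s t} → (Subset (s + t) → Set) → Matroid t → Set
ContractionIs {s} {t} K N = ∀ J → ContractS {s} {t} K J ⇔ Ind N J

IsSemidirectSum : ∀ {s t} → Matroid s → Matroid t → (Subset (s + t) → Set) → Set
IsSemidirectSum {s} {t} M N K =
  IsMatroid K × RestrictionIs {s} {t} K M × ContractionIs {s} {t} K N

module Submission where

-- An independent set of K has the shape
-- I₁ ∪ (∅ ++ J′) with I₁ independent in M⁺ and J′ independent in N.
--
--  (1) K is a matroid.  Adding loops preserves the matroid axioms, and so does
--      matroid union.  For the union only augmentation is nontrivial; it is the
--      classical exchange argument: fix disjoint decompositions of the smaller
--      set I and the larger set J, augment one side of I from the same side of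
--      J, and if the new element already lies on the other side of I, move it
--      across.  Each move strictly decreases a distance between the two
--      decompositions, so a genuine augmenting element is eventually found.
--  (2) K|S = M, because N₀ has nothing but loops on S, so K|S = M⁺|S = M.
--  (3) K/S = N.  A basis B of K|S = M has k elements.  If B ∪ J = I₁ ∪ (∅ ++ J′)
--      is independent in K, then |B| + |J| ≤ |I₁| + |J′| ≤ k + |J′| ≤ |B| + |J′|
--      and J′ ⊆ J, hence J = J′ is independent in N.  Conversely, for a basis
--      B of M and J independent in N, B ∪ J = (B ++ ∅) ∪ (∅ ++ J).

open import Defs
open import Data.Nat using (ℕ; zero; suc; _+_; _≤_; _<_; s≤s; s≤s⁻¹; _<?_)
open import Data.Nat.Properties
open import Data.Bool using (true; false; _∨_)
import Data.Bool.Properties as Bool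
open import Data.Fin using (Fin; zero; suc; _↑ˡ_; _↑ʳ_)
open import Data.Fin.Subset
open import Data.Fin.Subset.Properties
open import Data.Vec using ([]; _∷_; _++_; splitAt)
open import Data.Vec.Base using (here; there)
import Data.Vec.Properties as Vec
open import Data.Product using (Σ; _×_; _,_; proj₁; proj₂)
open import Data.Sum using (_⊎_; inj₁; inj₂)
open import Data.Empty using (⊥-elim)
open import Relation.Nullary using (Dec; yes; no; ¬_)
open import Relation.Nullary.Decidable using (_×-dec_; map′)
open import Relation.Binary.PropositionalEquality
open import Function using (_∘_)
open import Function.Bundles using (_⇔_; mk⇔; Equivalence)
open import Function.Properties.Equivalence using () renaming (trans to ⇔-trans)

open Equivalence using (to; from)
open IsMatroid

-- Subsets of S ∪ T = Fin (s + t) and their cardinalities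

∣++∣ : ∀ {s t} (A : Subset s) (B : Subset t) → ∣ A ++ B ∣ ≡ ∣ A ∣ + ∣ B ∣
∣++∣ []          B = refl
∣++∣ (true ∷ A)  B = cong suc (∣++∣ A B)
∣++∣ (false ∷ A) B = ∣++∣ A B

∣⊥++∣ : ∀ {s t} (B : Subset t) → ∣ ⊥ {s} ++ B ∣ ≡ ∣ B ∣
∣⊥++∣ {s} B = trans (∣++∣ (⊥ {s}) B) (cong (_+ ∣ B ∣) (∣⊥∣≡0 s))

⊥++⊥ : ∀ s t → ⊥ {s + t} ≡ ⊥ {s} ++ ⊥ {t}
⊥++⊥ zero    t = refl
⊥++⊥ (suc s) t = cong (false ∷_) (⊥++⊥ s t)

∪-++ : ∀ {s t} (A C : Subset s) (B D : Subset t) →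
       (A ++ B) ∪ (C ++ D) ≡ (A ∪ C) ++ (B ∪ D)
∪-++ A C B D = Vec.zipWith-++ _∨_ A B C D

⁅↑ʳ⁆ : ∀ s {t} (x : Fin t) → ⁅ s ↑ʳ x ⁆ ≡ ⊥ {s} ++ ⁅ x ⁆
⁅↑ʳ⁆ zero    x = refl
⁅↑ʳ⁆ (suc s) x = cong (false ∷_) (⁅↑ʳ⁆ s x)

∈-↑ˡ⁻ : ∀ {s t} {x : Fin s} (A : Subset s) (B : Subset t) → x ↑ˡ t ∈ A ++ B → x ∈ A
∈-↑ˡ⁻ {x = x} A B x∈ =
  Vec.lookup⇒[]= x A (trans (sym (Vec.lookup-++ˡ A B x)) (Vec.[]=⇒lookup x∈))

∈-↑ˡ⁺ : ∀ {s t} {x : Fin s} (A : Subset s) (B : Subset t) → x ∈ A → x ↑ˡ t ∈ A ++ B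
∈-↑ˡ⁺ {t = t} {x} A B x∈ =
  Vec.lookup⇒[]= (x ↑ˡ t) (A ++ B) (trans (Vec.lookup-++ˡ A B x) (Vec.[]=⇒lookup x∈))

∈-↑ʳ⁻ : ∀ {s t} {x : Fin t} (A : Subset s) (B : Subset t) → s ↑ʳ x ∈ A ++ B → x ∈ B
∈-↑ʳ⁻ {x = x} A B x∈ =
  Vec.lookup⇒[]= x B (trans (sym (Vec.lookup-++ʳ A B x)) (Vec.[]=⇒lookup x∈))

∈-↑ʳ⁺ : ∀ {s t} {x : Fin t} (A : Subset s) (B : Subset t) → x ∈ B → s ↑ʳ x ∈ A ++ B
∈-↑ʳ⁺ {s} {x = x} A B x∈ =
  Vec.lookup⇒[]= (s ↑ʳ x) (A ++ B) (trans (Vec.lookup-++ʳ A B x) (Vec.[]=⇒lookup x∈))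

⊆-++ : ∀ {s t} (A C : Subset s) (B D : Subset t) →
       A ++ B ⊆ C ++ D → A ⊆ C × B ⊆ D
⊆-++ A C B D h = (λ x∈A → ∈-↑ˡ⁻ C D (h (∈-↑ˡ⁺ A B x∈A)))
               , (λ x∈B → ∈-↑ʳ⁻ C D (h (∈-↑ʳ⁺ A B x∈B)))

⊆⊥⇒≡⊥ : ∀ {n} {p : Subset n} → p ⊆ ⊥ → p ≡ ⊥
⊆⊥⇒≡⊥ {p = p} h = ⊆-antisym h (⊆-min p)

⊆-∣∣-≡ : ∀ {n} (p q : Subset n) → p ⊆ q → ∣ q ∣ ≤ ∣ p ∣ → p ≡ q
⊆-∣∣-≡ []          []          h le = refl
⊆-∣∣-≡ (true ∷ p)  (true ∷ q)  h le = cong (true ∷_) (⊆-∣∣-≡ p q (drop-∷-⊆ h) (s≤s⁻¹ le))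
⊆-∣∣-≡ (false ∷ p) (false ∷ q) h le = cong (false ∷_) (⊆-∣∣-≡ p q (drop-∷-⊆ h) le)
⊆-∣∣-≡ (true ∷ p)  (false ∷ q) h le with h here
... | ()
⊆-∣∣-≡ (false ∷ p) (true ∷ q)  h le = ⊥-elim (<⇒≱ le (p⊆q⇒∣p∣≤∣q∣ (drop-∷-⊆ h)))

∪-─ : ∀ {n} (p q : Subset n) → p ∪ (q ─ p) ≡ p ∪ q
∪-─ []          []      = refl
∪-─ (true ∷ p)  (b ∷ q) = cong (true ∷_) (∪-─ p q)
∪-─ (false ∷ p) (b ∷ q) = cong (b ∷_) (∪-─ p q)

∩-─ : ∀ {n} (p q : Subset n) → p ∩ (q ─ p) ≡ ⊥
∩-─ []          []      = refl
∩-─ (true ∷ p)  (b ∷ q) = cong (false ∷_) (∩-─ p q)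
∩-─ (false ∷ p) (b ∷ q) = cong (false ∷_) (∩-─ p q)

∣∪∣-disjoint : ∀ {n} (p q : Subset n) → p ∩ q ≡ ⊥ → ∣ p ∪ q ∣ ≡ ∣ p ∣ + ∣ q ∣
∣∪∣-disjoint []          []          e = refl
∣∪∣-disjoint (true ∷ p)  (true ∷ q)  ()
∣∪∣-disjoint (true ∷ p)  (false ∷ q) e = cong suc (∣∪∣-disjoint p q (Vec.∷-injectiveʳ e))
∣∪∣-disjoint (false ∷ p) (true ∷ q)  e =
  trans (cong suc (∣∪∣-disjoint p q (Vec.∷-injectiveʳ e))) (sym (+-suc ∣ p ∣ ∣ q ∣))
∣∪∣-disjoint (false ∷ p) (false ∷ q) e = ∣∪∣-disjoint p q (Vec.∷-injectiveʳ e)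

∣∪∣≤ : ∀ {n} (p q : Subset n) → ∣ p ∪ q ∣ ≤ ∣ p ∣ + ∣ q ∣
∣∪∣≤ p q = begin
  ∣ p ∪ q ∣           ≡⟨ cong ∣_∣ (sym (∪-─ p q)) ⟩
  ∣ p ∪ (q ─ p) ∣     ≡⟨ ∣∪∣-disjoint p (q ─ p) (∩-─ p q) ⟩
  ∣ p ∣ + ∣ q ─ p ∣   ≤⟨ +-monoʳ-≤ ∣ p ∣ (∣p─q∣≤∣p∣ q p) ⟩
  ∣ p ∣ + ∣ q ∣       ∎
  where open ≤-Reasoning

⊆∪⇒≡∩∪∩ : ∀ {n} (r p q : Subset n) → r ⊆ p ∪ q → r ≡ (r ∩ p) ∪ (r ∩ q)
⊆∪⇒≡∩∪∩ r p q h = trans (sym r∩[p∪q]≡r) (∩-distribˡ-∪ r p q)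
  where
    r∩[p∪q]≡r : r ∩ (p ∪ q) ≡ r
    r∩[p∪q]≡r = ⊆-antisym (p∩q⊆p r (p ∪ q)) (λ x∈r → x∈p∩q⁺ (x∈r , h x∈r))

-- Facts used when an element x is moved from one side of a decomposition to the other.
⁅x⁆∪[p-x] : ∀ {n} (x : Fin n) (p : Subset n) → x ∈ p → ⁅ x ⁆ ∪ (p - x) ≡ p
⁅x⁆∪[p-x] zero    (true ∷ p) here = cong (true ∷_) (trans (∪-identityˡ (p ─ ⊥)) (p─⊥≡p p))
⁅x⁆∪[p-x] (suc x) (b ∷ p) (there x∈p) = cong (b ∷_) (⁅x⁆∪[p-x] x p x∈p)

[p∪r]∩[q─r] : ∀ {n} (p q r : Subset n) → p ∩ q ≡ ⊥ → (p ∪ r) ∩ (q ─ r) ≡ ⊥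
[p∪r]∩[q─r] []          []          []          e = refl
[p∪r]∩[q─r] (true ∷ p)  (true ∷ q)  (b ∷ r)     ()
[p∪r]∩[q─r] (true ∷ p)  (false ∷ q) (true ∷ r)  e =
  cong (false ∷_) ([p∪r]∩[q─r] p q r (Vec.∷-injectiveʳ e))
[p∪r]∩[q─r] (true ∷ p)  (false ∷ q) (false ∷ r) e =
  cong (false ∷_) ([p∪r]∩[q─r] p q r (Vec.∷-injectiveʳ e))
[p∪r]∩[q─r] (false ∷ p) (c ∷ q)     (true ∷ r)  e =
  cong (false ∷_) ([p∪r]∩[q─r] p q r (Vec.∷-injectiveʳ e))
[p∪r]∩[q─r] (false ∷ p) (c ∷ q)     (false ∷ r) e =
  cong (false ∷_) ([p∪r]∩[q─r] p q r (Vec.∷-injectiveʳ e))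

q─[p-x] : ∀ {n} (x : Fin n) (q p : Subset n) → x ∉ q → q ─ (p - x) ≡ q ─ p
q─[p-x] zero    (true ∷ q)  (b ∷ p)     x∉q = ⊥-elim (x∉q here)
q─[p-x] zero    (false ∷ q) (true ∷ p)  x∉q = cong (false ∷_) (cong (q ─_) (p─⊥≡p p))
q─[p-x] zero    (false ∷ q) (false ∷ p) x∉q = cong (false ∷_) (cong (q ─_) (p─⊥≡p p))
q─[p-x] (suc x) (c ∷ q)     (true ∷ p)  x∉q = cong (false ∷_) (q─[p-x] x q p (x∉q ∘ there))
q─[p-x] (suc x) (c ∷ q)     (false ∷ p) x∉q = cong (c ∷_) (q─[p-x] x q p (x∉q ∘ there))

-- Bases and transport of matroid structure

-- B is a basis of the family Ind: a maximal member.  Note that the basis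
-- notion IsBasisS K of K|S is, by definition, IsBasis (RestrictS K).
IsBasis : ∀ {n} → (Subset n → Set) → Subset n → Set
IsBasis Ind B = Ind B × (∀ B′ → B ⊆ B′ → Ind B′ → B′ ≡ B)

max-size⇒basis : ∀ {n k} {Ind : Subset n → Set} {B : Subset n} →
                 HasRank Ind k → Ind B → ∣ B ∣ ≡ k → IsBasis Ind B
max-size⇒basis {B = B} (_ , bound) indB ∣B∣≡k =
  indB , λ B′ B⊆B′ indB′ →
    sym (⊆-∣∣-≡ B B′ B⊆B′ (subst (∣ B′ ∣ ≤_) (sym ∣B∣≡k) (bound B′ indB′)))

-- In a matroid every basis has maximum size: a smaller basis could be
-- augmented from an independent set of maximum size.
basis⇒max-size : ∀ {n k} {Ind : Subset n → Set} {B : Subset n} →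
                 IsMatroid Ind → HasRank Ind k → IsBasis Ind B → k ≤ ∣ B ∣
basis⇒max-size {B = B} m ((I , indI , ∣I∣≡k) , _) (indB , maximal)
  with ∣ B ∣ <? ∣ I ∣
... | no ∣B∣≮∣I∣ = subst (_≤ ∣ B ∣) ∣I∣≡k (≮⇒≥ ∣B∣≮∣I∣)
... | yes ∣B∣<∣I∣ with ind-aug m indB indI ∣B∣<∣I∣
...   | x , _ , x∉B , indB+x = ⊥-elim (x∉B (subst (x ∈_) B+x≡B x∈B+x))
  where
    B+x≡B : B ∪ ⁅ x ⁆ ≡ B
    B+x≡B = maximal (B ∪ ⁅ x ⁆) (p⊆p∪q ⁅ x ⁆) indB+x
    x∈B+x : x ∈ B ∪ ⁅ x ⁆
    x∈B+x = x∈p∪q⁺ (inj₂ (x∈⁅x⁆ x))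

isMatroid-⇔ : ∀ {n} {P Q : Subset n → Set} →
              (∀ A → P A ⇔ Q A) → IsMatroid Q → IsMatroid P
isMatroid-⇔ {P = P} P⇔Q m = record
  { ind-dec    = λ A → map′ (from (P⇔Q A)) (to (P⇔Q A)) (ind-dec m A)
  ; ind-empty  = from (P⇔Q ⊥) (ind-empty m)
  ; ind-subset = λ {I} {J} J⊆I PI → from (P⇔Q J) (ind-subset m J⊆I (to (P⇔Q I) PI))
  ; ind-aug    = augment
  }
  where
    augment : ∀ {I J} → P I → P J → ∣ I ∣ < ∣ J ∣ →
              Σ _ λ x → x ∈ J × x ∉ I × P (I ∪ ⁅ x ⁆)
    augment {I} {J} PI PJ lt with ind-aug m (to (P⇔Q I) PI) (to (P⇔Q J) PJ) lt
    ... | x , x∈J , x∉I , QI+x = x , x∈J , x∉I , from (P⇔Q _) QI+x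

hasRank-⇔ : ∀ {n k} {P Q : Subset n → Set} →
            (∀ A → P A ⇔ Q A) → HasRank Q k → HasRank P k
hasRank-⇔ P⇔Q ((I , QI , ∣I∣≡k) , bound) =
  (I , from (P⇔Q I) QI , ∣I∣≡k) , λ A PA → bound A (to (P⇔Q A) PA)

-- N₀ = N ⊕ U_{0,S} is a matroid

loopsExt-++ : ∀ {s t} (N : Matroid t) (A : Subset s) (B : Subset t) →
              LoopsExt {s} {t} N (A ++ B) ⇔ (A ≡ ⊥ × Ind N B)
loopsExt-++ N A B = mk⇔
  (λ (C , e , indC) → Vec.++-injectiveˡ A ⊥ e
                    , subst (Ind N) (sym (Vec.++-injectiveʳ A ⊥ e)) indC)
  (λ (A≡⊥ , indB) → B , cong (_++ B) A≡⊥ , indB)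

loops-isMatroid : ∀ {s t} (N : Matroid t) → IsMatroid (LoopsExt {s} {t} N)
loops-isMatroid {s} {t} N = record
  { ind-dec    = decide
  ; ind-empty  = ⊥ , ⊥++⊥ s t , ind-empty mN
  ; ind-subset = shrink
  ; ind-aug    = augment
  }
  where
    mN : IsMatroid (Ind N)
    mN = isMatroid N

    decide : ∀ I → Dec (LoopsExt {s} {t} N I)
    decide I with splitAt s I
    ... | A , B , refl = map′ (from (loopsExt-++ N A B)) (to (loopsExt-++ N A B))
                              (Vec.≡-dec Bool._≟_ A ⊥ ×-dec ind-dec mN B)

    shrink : ∀ {I J} → J ⊆ I → LoopsExt {s} {t} N I → LoopsExt {s} {t} N J
    shrink {J = J} J⊆I (C , refl , indC) with splitAt s J
    ... | A , B , refl = from (loopsExt-++ N A B)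
                              (⊆⊥⇒≡⊥ (proj₁ parts) , ind-subset mN (proj₂ parts) indC)
      where
        parts : A ⊆ ⊥ × B ⊆ C
        parts = ⊆-++ A ⊥ B C J⊆I

    augment : ∀ {I J} → LoopsExt {s} {t} N I → LoopsExt {s} {t} N J → ∣ I ∣ < ∣ J ∣ →
              Σ _ λ x → x ∈ J × x ∉ I × LoopsExt {s} {t} N (I ∪ ⁅ x ⁆)
    augment (C , refl , indC) (D , refl , indD) lt
      with ind-aug mN indC indD (subst₂ _<_ (∣⊥++∣ {s} C) (∣⊥++∣ {s} D) lt)
    ... | x , x∈D , x∉C , indC+x =
      s ↑ʳ x , ∈-↑ʳ⁺ ⊥ D x∈D , x∉C ∘ ∈-↑ʳ⁻ ⊥ C , C ∪ ⁅ x ⁆ , embed , indC+x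
      where
        embed : (⊥ ++ C) ∪ ⁅ s ↑ʳ x ⁆ ≡ ⊥ ++ (C ∪ ⁅ x ⁆)
        embed = begin
          (⊥ ++ C) ∪ ⁅ s ↑ʳ x ⁆     ≡⟨ cong ((⊥ ++ C) ∪_) (⁅↑ʳ⁆ s x) ⟩
          (⊥ ++ C) ∪ (⊥ ++ ⁅ x ⁆)   ≡⟨ ∪-++ ⊥ ⊥ C ⁅ x ⁆ ⟩
          (⊥ ∪ ⊥) ++ (C ∪ ⁅ x ⁆)    ≡⟨ cong (_++ (C ∪ ⁅ x ⁆)) (∪-identityˡ ⊥) ⟩
          ⊥ ++ (C ∪ ⁅ x ⁆)          ∎
          where open ≡-Reasoning

-- The union G ∨ H of two matroids is a matroid

record Split {n} (G H : Subset n → Set) (X : Subset n) : Set where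
  constructor split
  field
    left right : Subset n
    left-ind   : G left
    right-ind  : H right
    covers     : X ≡ left ∪ right
    disjoint   : left ∩ right ≡ ⊥
open Split

module _ {n} {G H : Subset n → Set} where

  toSplit : ∀ {X} → IsMatroid H → UnionInd G H X → Split G H X
  toSplit mH (A , B , indA , indB , e) =
    split A (B ─ A) indA (ind-subset mH (p─q⊆p B A) indB)
          (trans e (sym (∪-─ A B))) (∩-─ A B)

  swap : ∀ {X} → Split G H X → Split H G X
  swap (split A B indA indB e d) =
    split B A indB indA (trans e (∪-comm A B)) (trans (∩-comm B A) d)

  split-size : ∀ {X} (σ : Split G H X) → ∣ X ∣ ≡ ∣ left σ ∣ + ∣ right σ ∣
  split-size σ = trans (cong ∣_∣ (covers σ)) (∣∪∣-disjoint (left σ) (right σ) (disjoint σ))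

  Augmentation : Subset n → Subset n → Set
  Augmentation I J = Σ (Fin n) λ x → x ∈ J × x ∉ I × UnionInd G H (I ∪ ⁅ x ⁆)

  distance : ∀ {I J} → Split G H I → Split G H J → ℕ
  distance σ τ = ∣ left τ ─ left σ ∣ + ∣ right τ ─ right σ ∣

  extend-left : ∀ {I} (σ : Split G H I) {x : Fin n} →
                G (left σ ∪ ⁅ x ⁆) → UnionInd G H (I ∪ ⁅ x ⁆)
  extend-left (split A B _ indB e _) {x} indA+x = A ∪ ⁅ x ⁆ , B , indA+x , indB , reorder
    where
      reorder : _ ∪ ⁅ x ⁆ ≡ (A ∪ ⁅ x ⁆) ∪ B
      reorder = begin
        _ ∪ ⁅ x ⁆           ≡⟨ cong (_∪ ⁅ x ⁆) e ⟩
        (A ∪ B) ∪ ⁅ x ⁆     ≡⟨ ∪-assoc A B ⁅ x ⁆ ⟩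
        A ∪ (B ∪ ⁅ x ⁆)     ≡⟨ cong (A ∪_) (∪-comm B ⁅ x ⁆) ⟩
        A ∪ (⁅ x ⁆ ∪ B)     ≡⟨ sym (∪-assoc A ⁅ x ⁆ B) ⟩
        (A ∪ ⁅ x ⁆) ∪ B     ∎
        where open ≡-Reasoning

  shift : ∀ {I} → IsMatroid H → (σ : Split G H I) {x : Fin n} →
          x ∈ right σ → G (left σ ∪ ⁅ x ⁆) → Split G H I
  shift mH (split A B _ indB e d) {x} x∈B indA+x =
    split (A ∪ ⁅ x ⁆) (B - x) indA+x (ind-subset mH (p─q⊆p B ⁅ x ⁆) indB)
          moved ([p∪r]∩[q─r] A B ⁅ x ⁆ d)
    where
      moved : _ ≡ (A ∪ ⁅ x ⁆) ∪ (B - x)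
      moved = begin
        _                       ≡⟨ e ⟩
        A ∪ B                   ≡⟨ cong (A ∪_) (sym (⁅x⁆∪[p-x] x B x∈B)) ⟩
        A ∪ (⁅ x ⁆ ∪ (B - x))   ≡⟨ sym (∪-assoc A ⁅ x ⁆ (B - x)) ⟩
        (A ∪ ⁅ x ⁆) ∪ (B - x)   ∎
        where open ≡-Reasoning

  shift-closer : ∀ {I J} (mH : IsMatroid H) (σ : Split G H I) (τ : Split G H J) {x : Fin n}
                 (x∈B : x ∈ right σ) (indA+x : G (left σ ∪ ⁅ x ⁆)) →
                 x ∈ left τ → x ∉ left σ →
                 distance (shift mH σ x∈B indA+x) τ < distance σ τ
  shift-closer mH (split A B _ _ _ _) (split C D _ _ _ d) {x} _ _ x∈C x∉A = begin-strict
    ∣ C ─ (A ∪ ⁅ x ⁆) ∣ + ∣ D ─ (B - x) ∣   ≡⟨ cong₂ _+_ (cong ∣_∣ (sym (p─q─r≡p─q∪r C A ⁅ x ⁆)))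
                                                        (cong ∣_∣ (q─[p-x] x D B x∉D)) ⟩
    ∣ (C ─ A) - x ∣ + ∣ D ─ B ∣             <⟨ +-monoˡ-< ∣ D ─ B ∣ (x∈p⇒∣p-x∣<∣p∣ (x∈p∧x∉q⇒x∈p─q x∈C x∉A)) ⟩
    ∣ C ─ A ∣ + ∣ D ─ B ∣                   ∎
    where
      open ≤-Reasoning
      x∉D : x ∉ D
      x∉D x∈D = ∉⊥ (subst (x ∈_) d (x∈p∩q⁺ (x∈C , x∈D)))

  exchange : ∀ {I J} → IsMatroid G → IsMatroid H →
             (σ : Split G H I) (τ : Split G H J) → ∣ left σ ∣ < ∣ left τ ∣ →
             Augmentation I J ⊎ Σ (Split G H I) λ σ′ → distance σ′ τ < distance σ τ
  exchange mG mH σ τ lt with ind-aug mG (left-ind σ) (left-ind τ) lt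
  ... | x , x∈C , x∉A , indA+x with x ∈? right σ
  ...   | yes x∈B = inj₂ (shift mH σ x∈B indA+x , shift-closer mH σ τ x∈B indA+x x∈C x∉A)
  ...   | no  x∉B = inj₁ (x , x∈J , x∉I , extend-left σ indA+x)
    where
      x∈J : x ∈ _
      x∈J = subst (x ∈_) (sym (covers τ)) (x∈p∪q⁺ (inj₁ x∈C))
      x∉I : x ∉ _
      x∉I x∈I with x∈p∪q⁻ (left σ) (right σ) (subst (x ∈_) (covers σ) x∈I)
      ... | inj₁ x∈A = x∉A x∈A
      ... | inj₂ x∈B = x∉B x∈B

  right-smaller : ∀ {I J} (σ : Split G H I) (τ : Split G H J) → ∣ I ∣ < ∣ J ∣ →
                  ¬ ∣ left σ ∣ < ∣ left τ ∣ → ∣ right σ ∣ < ∣ right τ ∣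
  right-smaller {I} {J} σ τ ∣I∣<∣J∣ left≮ = +-cancelˡ-< ∣ left τ ∣ _ _ (begin-strict
    ∣ left τ ∣ + ∣ right σ ∣     ≤⟨ +-monoˡ-≤ ∣ right σ ∣ (≮⇒≥ left≮) ⟩
    ∣ left σ ∣ + ∣ right σ ∣     ≡⟨ sym (split-size σ) ⟩
    ∣ I ∣                        <⟨ ∣I∣<∣J∣ ⟩
    ∣ J ∣                        ≡⟨ cong ∣_∣ (covers τ) ⟩
    ∣ left τ ∪ right τ ∣         ≤⟨ ∣∪∣≤ (left τ) (right τ) ⟩
    ∣ left τ ∣ + ∣ right τ ∣     ∎)
    where open ≤-Reasoning

swap-union : ∀ {n} {G H : Subset n → Set} {X} → UnionInd H G X → UnionInd G H X
swap-union (A , B , indA , indB , e) = B , A , indB , indA , trans e (∪-comm A B)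

swap-distance : ∀ {n} {G H : Subset n → Set} {I J} (σ : Split H G I) (τ : Split G H J) →
                distance (swap σ) τ ≡ distance σ (swap τ)
swap-distance σ τ = +-comm ∣ left τ ─ right σ ∣ ∣ right τ ─ left σ ∣

swap-swap-distance : ∀ {n} {G H : Subset n → Set} {I J} (σ : Split G H I) (τ : Split G H J) →
                     distance (swap σ) (swap τ) ≡ distance σ τ
swap-swap-distance σ τ = +-comm ∣ right τ ─ right σ ∣ ∣ left τ ─ left σ ∣

-- Repeated exchange steps, on whichever side is smaller, find an augmentation;
-- the strictly decreasing distance is bounded by the fuel.
augment-within : ∀ {n} {G H : Subset n → Set} {I J} → IsMatroid G → IsMatroid H →
                 ∣ I ∣ < ∣ J ∣ → (fuel : ℕ) (σ : Split G H I) (τ : Split G H J) →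
                 distance σ τ < fuel → Augmentation {G = G} {H} I J
augment-within mG mH ∣I∣<∣J∣ (suc fuel) σ τ (s≤s d≤fuel) with ∣ left σ ∣ <? ∣ left τ ∣
... | yes left< with exchange mG mH σ τ left<
...   | inj₁ aug           = aug
...   | inj₂ (σ′ , closer) = augment-within mG mH ∣I∣<∣J∣ fuel σ′ τ (<-≤-trans closer d≤fuel)
augment-within mG mH ∣I∣<∣J∣ (suc fuel) σ τ (s≤s d≤fuel) | no left≮
  with exchange mH mG (swap σ) (swap τ) (right-smaller σ τ ∣I∣<∣J∣ left≮)
...   | inj₁ (x , x∈J , x∉I , ind) = x , x∈J , x∉I , swap-union ind
...   | inj₂ (σ′ , closer)         = augment-within mG mH ∣I∣<∣J∣ fuel (swap σ′) τ
  (begin-strict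
    distance (swap σ′) τ          ≡⟨ swap-distance σ′ τ ⟩
    distance σ′ (swap τ)          <⟨ closer ⟩
    distance (swap σ) (swap τ)    ≡⟨ swap-swap-distance σ τ ⟩
    distance σ τ                  ≤⟨ d≤fuel ⟩
    fuel                          ∎)
  where open ≤-Reasoning

union-isMatroid : ∀ {n} {G H : Subset n → Set} →
                  IsMatroid G → IsMatroid H → IsMatroid (UnionInd G H)
union-isMatroid {G = G} {H} mG mH = record
  { ind-dec    = λ X → anySubset? λ A → anySubset? λ B →
                   ind-dec mG A ×-dec ind-dec mH B ×-dec Vec.≡-dec Bool._≟_ X (A ∪ B)
  ; ind-empty  = ⊥ , ⊥ , ind-empty mG , ind-empty mH , sym (∪-identityˡ ⊥)
  ; ind-subset = shrink
  ; ind-aug    = λ indI indJ ∣I∣<∣J∣ →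
      let σ = toSplit mH indI ; τ = toSplit mH indJ
      in augment-within mG mH ∣I∣<∣J∣ (suc (distance σ τ)) σ τ (n<1+n _)
  }
  where
    shrink : ∀ {X Y} → Y ⊆ X → UnionInd G H X → UnionInd G H Y
    shrink {Y = Y} Y⊆X (A , B , indA , indB , refl) =
      Y ∩ A , Y ∩ B , ind-subset mG (p∩q⊆q Y A) indA , ind-subset mH (p∩q⊆q Y B) indB ,
      ⊆∪⇒≡∩∪∩ Y A B Y⊆X

-- Restriction and contraction of G ∨ N₀ along S

-- N₀ has only loops on S, so (G ∨ N₀)|S = G|S.
restrict-union-loops : ∀ {s t} (G : Subset (s + t) → Set) (N : Matroid t) (A : Subset s) →
                       RestrictS {s} {t} (UnionInd G (LoopsExt {s} {t} N)) A ⇔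
                       RestrictS {s} {t} G A
restrict-union-loops {s} {t} G N A = mk⇔ drop-loops add-loops
  where
    drop-loops : UnionInd G (LoopsExt {s} {t} N) (A ++ ⊥) → G (A ++ ⊥)
    drop-loops (I₁ , _ , indI₁ , (C , refl , _) , e) = subst G (sym A++⊥≡I₁) indI₁
      where
        C≡⊥ : C ≡ ⊥
        C≡⊥ = ⊆⊥⇒≡⊥ (proj₂ (⊆-++ ⊥ A C ⊥ λ x∈ → subst (_ ∈_) (sym e) (q⊆p∪q I₁ _ x∈)))
        A++⊥≡I₁ : A ++ ⊥ ≡ I₁
        A++⊥≡I₁ = begin
          A ++ ⊥              ≡⟨ e ⟩
          I₁ ∪ (⊥ ++ C)       ≡⟨ cong (λ D → I₁ ∪ (⊥ ++ D)) C≡⊥ ⟩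
          I₁ ∪ (⊥ {s} ++ ⊥ {t}) ≡⟨ cong (I₁ ∪_) (sym (⊥++⊥ s t)) ⟩
          I₁ ∪ ⊥              ≡⟨ ∪-identityʳ I₁ ⟩
          I₁                  ∎
          where open ≡-Reasoning

    add-loops : G (A ++ ⊥) → UnionInd G (LoopsExt {s} {t} N) (A ++ ⊥)
    add-loops indA = A ++ ⊥ , ⊥ , indA , (⊥ , ⊥++⊥ s t , ind-empty (isMatroid N)) ,
                     sym (∪-identityʳ (A ++ ⊥))

-- If B ⊆ S has at least r(G) elements and B ∪ J is independent in G ∨ N₀, then
-- J is independent in N: the G-part covers at most |B| elements, so the
-- N-part, a subset of J, must be all of J.
contract-union-loops : ∀ {s t k} {G : Subset (s + t) → Set} (N : Matroid t)
                       {B : Subset s} {J : Subset t} →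
                       (∀ I → G I → ∣ I ∣ ≤ k) → k ≤ ∣ B ∣ →
                       UnionInd G (LoopsExt {s} {t} N) (B ++ J) → Ind N J
contract-union-loops {s} N {B} {J} bound k≤∣B∣ (I₁ , _ , indI₁ , (J′ , refl , indJ′) , e) =
  subst (Ind N) (⊆-∣∣-≡ J′ J J′⊆J ∣J∣≤∣J′∣) indJ′
  where
    J′⊆J : J′ ⊆ J
    J′⊆J = proj₂ (⊆-++ ⊥ B J′ J λ x∈ → subst (_ ∈_) (sym e) (q⊆p∪q I₁ _ x∈))
    ∣J∣≤∣J′∣ : ∣ J ∣ ≤ ∣ J′ ∣
    ∣J∣≤∣J′∣ = +-cancelˡ-≤ ∣ B ∣ _ _ (begin
      ∣ B ∣ + ∣ J ∣           ≡⟨ sym (∣++∣ B J) ⟩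
      ∣ B ++ J ∣              ≡⟨ cong ∣_∣ e ⟩
      ∣ I₁ ∪ (⊥ {s} ++ J′) ∣  ≤⟨ ∣∪∣≤ I₁ (⊥ ++ J′) ⟩
      ∣ I₁ ∣ + ∣ ⊥ {s} ++ J′ ∣ ≡⟨ cong (∣ I₁ ∣ +_) (∣⊥++∣ {s} J′) ⟩
      ∣ I₁ ∣ + ∣ J′ ∣         ≤⟨ +-monoˡ-≤ ∣ J′ ∣ (≤-trans (bound I₁ indI₁) k≤∣B∣) ⟩
      ∣ B ∣ + ∣ J′ ∣          ∎)
      where open ≤-Reasoning

extend-union-loops : ∀ {s t} {G : Subset (s + t) → Set} {N : Matroid t}
                     {B : Subset s} {J : Subset t} →
                     G (B ++ ⊥) → Ind N J → UnionInd G (LoopsExt {s} {t} N) (B ++ J)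
extend-union-loops {B = B} {J} indB indJ =
  B ++ ⊥ , ⊥ ++ J , indB , (J , refl , indJ) ,
  sym (trans (∪-++ B ⊥ ⊥ J) (cong₂ _++_ (∪-identityʳ B) (∪-identityˡ J)))

theorem2p6 : (s t : ℕ) (M : Matroid s) (N : Matroid t) (M⁺ : Matroid (s + t)) →
    RestrictionIs {s} {t} (Ind M⁺) M →
    Σ ℕ (λ k → HasRank (Ind M) k × HasRank (Ind M⁺) k) →
    IsSemidirectSum {s} {t} M N (UnionInd (Ind M⁺) (LoopsExt {s} {t} N))
theorem2p6 s t M N M⁺ M⁺|S=M (k , rankM , (_ , boundM⁺)) =
  union-isMatroid (isMatroid M⁺) (loops-isMatroid N) , K|S=M , K/S=N
  where
    K : Subset (s + t) → Set
    K = UnionInd (Ind M⁺) (LoopsExt {s} {t} N)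

    K|S=M : RestrictionIs {s} {t} K M
    K|S=M A = ⇔-trans (restrict-union-loops (Ind M⁺) N A) (M⁺|S=M A)

    -- K|S is a matroid of rank k, so its bases are its k-element independent sets.
    rank-K|S : HasRank (RestrictS {s} {t} K) k
    rank-K|S = hasRank-⇔ K|S=M rankM

    basis-size : ∀ {B} → IsBasisS {s} {t} K B → k ≤ ∣ B ∣
    basis-size = basis⇒max-size (isMatroid-⇔ K|S=M (isMatroid M)) rank-K|S

    K/S=N : ContractionIs {s} {t} K N
    K/S=N J = mk⇔
      (λ (B , basisB , indB∪J) → contract-union-loops N boundM⁺ (basis-size basisB) indB∪J)
      (λ indJ → let (B , indB , ∣B∣≡k) = proj₁ rankM in
        B , max-size⇒basis rank-K|S (from (K|S=M B) indB) ∣B∣≡k ,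
        extend-union-loops {s} {t} {N = N} (from (M⁺|S=M B) indB) indJ)
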